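{- Let $\pi\in\operatorname{Av}_n(2143,3142)$, and let $h_1<h_2<\cdots<h_g$ be the horizontal gaps of $\pi$. For each $k$, let $\beta^k$ denote the subsequence of $\pi$ consisting of the entries at the positions strictly between $h_k$ and the next LR-maximum of $\pi$ after $h_k$ (or up to position $n$ if there is none). Then the subsequence of $\pi$ obtained by deleting all LR-maxima of $\pi$ is the concatenation $\beta^1\beta^2\cdots\beta^g$, and for all $1\le k<k'\le g$ every entry of $\beta^k$ is larger than every entry of $\beta^{k'}$; that is, this subsequence is order-isomorphic to the skew sum $\beta^1\ominus\beta^2\ominus\cdots\ominus\beta^g$ (with each $\beta^k$ standardized).
   Context: For a permutation $\pi$ of length $n$, an index $i$ is an LR-maximum if $\pi_j<\pi_i$ for all $j<i$. A horizontal gap is an index $i<n$ that is an LR-maximum while $i+1$ is not an LR-maximum (equivalently, an LR-maximum that is also a descent). $\operatorname{Av}_n(2143,3142)$ is the set of permutations of length $n$ avoiding both $2143$ and $3142$; $\ominus$ denotes skew sum. -}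

module Defs where

open import Data.Nat using (ℕ; suc)
open import Data.Fin using (Fin; toℕ; _<_; _≤_; _<?_; _≤?_)
open import Data.Fin.Properties using (all?; any?)
open import Data.List using (List; filter; map; allFin)
open import Data.Product using (Σ; _×_; ∃; ∃-syntax)
open import Relation.Nullary using (¬_; Dec; ¬?)
open import Relation.Nullary.Decidable using (_×-dec_; _→-dec_)
open import Relation.Binary.PropositionalEquality using (_≡_)
import Data.Nat.Properties as ℕP

-- A permutation of length n is an injective map π : Fin n → Fin n
-- (positions and values both 0-based; this does not affect order notions).

Contains2143 : ∀ {n} → (Fin n → Fin n) → Set
Contains2143 {n} π = ∃[ i ] ∃[ j ] ∃[ k ] ∃[ l ]
  (i < j × j < k × k < l × π j < π i × π i < π l × π l < π k)

Contains3142 : ∀ {n} → (Fin n → Fin n) → Set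
Contains3142 {n} π = ∃[ i ] ∃[ j ] ∃[ k ] ∃[ l ]
  (i < j × j < k × k < l × π j < π l × π l < π i × π i < π k)

IsLRMax : ∀ {n} → (Fin n → Fin n) → Fin n → Set
IsLRMax {n} π i = ∀ j → j < i → π j < π i

isLRMax? : ∀ {n} (π : Fin n → Fin n) (i : Fin n) → Dec (IsLRMax π i)
isLRMax? π i = all? (λ j → (j <? i) →-dec (π j <? π i))

IsHGap : ∀ {n} → (Fin n → Fin n) → Fin n → Set
IsHGap {n} π i = IsLRMax π i × ∃[ j ] (toℕ j ≡ suc (toℕ i) × ¬ IsLRMax π j)

isHGap? : ∀ {n} (π : Fin n → Fin n) (i : Fin n) → Dec (IsHGap π i)
isHGap? π i = isLRMax? π i ×-dec any? (λ j → (toℕ j ℕP.≟ suc (toℕ i)) ×-dec ¬? (isLRMax? π j))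

hgaps : ∀ {n} → (Fin n → Fin n) → List (Fin n)
hgaps {n} π = filter (isHGap? π) (allFin n)

nonLRMaxEntries : ∀ {n} → (Fin n → Fin n) → List (Fin n)
nonLRMaxEntries {n} π = map π (filter (λ i → ¬? (isLRMax? π i)) (allFin n))

InBlock : ∀ {n} → (Fin n → Fin n) → Fin n → Fin n → Set
InBlock {n} π h j = h < j × (∀ m → h < m → m ≤ j → ¬ IsLRMax π m)

inBlock? : ∀ {n} (π : Fin n → Fin n) (h j : Fin n) → Dec (InBlock π h j)
inBlock? π h j = (h <? j) ×-dec all? (λ m → (h <? m) →-dec ((m ≤? j) →-dec ¬? (isLRMax? π m)))

block : ∀ {n} → (Fin n → Fin n) → Fin n → List (Fin n)
block {n} π h = map π (filter (inBlock? π h) (allFin n))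

-- Every non-LR-maximum j lies in the block of the last LR-maximum h before it,
-- and h is a horizontal gap since h+1 ≤ j is not an LR-maximum; so the blocks
-- partition the non-LR-maxima in increasing order of position. An entry of the
-- block of h is smaller than π h, the maximum of the prefix ending there. If
-- h < h′ are gaps, j is in the block of h and j′ in that of h′, then
-- h < j < h′ < j′ and π j, π j′ < π h < π h′; so π j < π j′ would give a 2143
-- (when π h < π j′) or a 3142 (when π j′ < π h).
module Submission where

open import Defs
open import Data.Nat using (ℕ; suc) renaming (_<_ to _<ℕ_; _≤_ to _≤ℕ_)
open import Data.Fin using (Fin; zero; suc; toℕ; fromℕ<; inject₁; _<_; _≤_; _<?_)
open import Data.List using (List; []; _∷_; map; concat; filter; allFin)
open import Data.List.Relation.Unary.All using (All)
open import Data.List.Relation.Unary.AllPairs using (AllPairs)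
open import Data.Product using (_×_; _,_; proj₂; ∃-syntax)
open import Relation.Nullary using (¬_)
open import Relation.Binary.PropositionalEquality using (_≡_)
open import Function.Definitions using (Injective)

import Data.Nat.Properties as ℕ
import Data.Fin.Properties as Fin
open import Data.Fin.Induction using (<-weakInduction)
open import Data.List.Properties using (map-∘; concat-map)
open import Data.List.Membership.Propositional.Properties
  using (∈-filter⁺; ∈-filter⁻; ∈-allFin; ∈-concat⁺′; ∈-concat⁻′; ∈-map⁺; ∈-map⁻)
open import Data.List.Relation.Binary.Subset.Propositional using (_⊆_)
open import Data.List.Relation.Unary.Any using (here; there)
import Data.List.Relation.Unary.All as All
import Data.List.Relation.Unary.All.Properties as All
import Data.List.Relation.Unary.AllPairs as AllPairs
import Data.List.Relation.Unary.AllPairs.Properties as AllPairs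
open import Data.Empty using (⊥-elim)
open import Data.Sum using (_⊎_; inj₁; inj₂)
open import Function using (_∘_; const)
open import Level using (Level)
open import Relation.Binary using (Rel; Asymmetric; tri<; tri≈; tri>)
open import Relation.Binary.PropositionalEquality using (refl; sym; cong; subst; module ≡-Reasoning)
open import Relation.Nullary using (yes; no; contradiction; ¬?)
open import Relation.Nullary.Decidable using (_→-dec_)
open import Relation.Unary using (Pred; Decidable)

private
  variable
    a ℓ₁ ℓ₂ ℓ₃ : Level
    A : Set a
    n : ℕ
    π : Fin n → Fin n
    h h′ j j′ : Fin n

all-cross : {P P′ : Pred A ℓ₁} {R : Rel A ℓ₂} {xs ys : List A} →
            (∀ {x y} → P x → P′ y → R x y) → All P xs → All P′ ys →
            All (λ x → All (R x) ys) xs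
all-cross f pxs pys = All.map (λ px → All.map (f px) pys) pxs

allPairs-filter : {P : Pred A ℓ₁} {Q : Rel A ℓ₂} {R : Rel A ℓ₃} (P? : Decidable P) {xs : List A} →
                  (∀ {x y} → P x → P y → Q x y → R x y) →
                  AllPairs Q xs → AllPairs R (filter P? xs)
allPairs-filter P? f AllPairs.[] = AllPairs.[]
allPairs-filter P? {x ∷ xs} f (x~xs AllPairs.∷ xs!) with P? x
... | yes px = All.map (λ (py , qxy) → f px py qxy)
                       (All.zip (All.all-filter P? xs , All.filter⁺ P? x~xs))
               AllPairs.∷ allPairs-filter P? f xs!
... | no _   = allPairs-filter P? f xs!

module _ {R : Rel A ℓ₃} (asym : Asymmetric R) where

  private
    head-≡ : ∀ {x y xs ys} → All (R x) xs → All (R y) ys →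
             x ∷ xs ⊆ y ∷ ys → y ∷ ys ⊆ x ∷ xs → x ≡ y
    head-≡ x~xs y~ys xs⊆ys ys⊆xs with xs⊆ys (here refl) | ys⊆xs (here refl)
    ... | here x≡y   | _          = x≡y
    ... | there _    | here y≡x   = sym y≡x
    ... | there x∈ys | there y∈xs = ⊥-elim (asym (All.lookup y~ys x∈ys) (All.lookup x~xs y∈xs))

    tail-⊆ : ∀ {x xs ys} → All (R x) xs → x ∷ xs ⊆ x ∷ ys → xs ⊆ ys
    tail-⊆ x~xs x∷xs⊆x∷ys z∈xs with x∷xs⊆x∷ys (there z∈xs)
    ... | here refl  = ⊥-elim (asym (All.lookup x~xs z∈xs) (All.lookup x~xs z∈xs))
    ... | there z∈ys = z∈ys

  sorted-unique : ∀ {xs ys} → AllPairs R xs → AllPairs R ys → xs ⊆ ys → ys ⊆ xs → xs ≡ ys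
  sorted-unique {[]}    {[]}    _ _ _ _ = refl
  sorted-unique {[]}    {_ ∷ _} _ _ _ ys⊆xs with () ← ys⊆xs (here refl)
  sorted-unique {_ ∷ _} {[]}    _ _ xs⊆ys _ with () ← xs⊆ys (here refl)
  sorted-unique {x ∷ _} {_ ∷ _} (x~xs AllPairs.∷ xs!) (y~ys AllPairs.∷ ys!) xs⊆ys ys⊆xs
    with refl ← head-≡ x~xs y~ys xs⊆ys ys⊆xs
    = cong (x ∷_) (sorted-unique xs! ys! (tail-⊆ x~xs xs⊆ys) (tail-⊆ y~ys ys⊆xs))

allFin-sorted : ∀ n → AllPairs _<_ (allFin n)
allFin-sorted n = AllPairs.tabulate⁺-< (λ i<j → i<j)

≤⇒≡⊎< : {m k : Fin n} → m ≤ k → m ≡ k ⊎ m < k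
≤⇒≡⊎< {m = m} {k} m≤k with m Fin.≟ k
... | yes m≡k = inj₁ m≡k
... | no  m≢k = inj₂ (Fin.≤∧≢⇒< m≤k m≢k)

dominated : ¬ IsLRMax π j → ∃[ k ] (k < j × π j ≤ π k)
dominated {π = π} {j = j} ¬lr
  with k , ¬[k<j⇒πk<πj] ← Fin.¬∀⟶∃¬ _ _ (λ k → (k <? j) →-dec (π k <? π j)) ¬lr
  with k <? j
... | yes k<j = k , k<j , ℕ.≮⇒≥ (¬[k<j⇒πk<πj] ∘ const)
... | no  k≮j = ⊥-elim (¬[k<j⇒πk<πj] (λ k<j → contradiction k<j k≮j))

record LastLRMaxUpTo (π : Fin n → Fin n) (j : Fin n) : Set where
  field
    pos       : Fin n
    pos≤j     : pos ≤ j
    isLRMax   : IsLRMax π pos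
    last      : ∀ m → pos < m → m ≤ j → ¬ IsLRMax π m
    dominates : ∀ k → k ≤ j → π k ≤ π pos

lastLRMax : (π : Fin n → Fin n) (j : Fin n) → LastLRMaxUpTo π j
lastLRMax {suc n} π = <-weakInduction (LastLRMaxUpTo π) first extend
  where
  first : LastLRMaxUpTo π zero
  first = record
    { pos       = zero
    ; pos≤j     = ℕ.≤-refl
    ; isLRMax   = λ _ ()
    ; last      = λ _ 0<m m≤0 _ → ℕ.<⇒≱ 0<m m≤0
    ; dominates = λ { zero _ → ℕ.≤-refl ; (suc _) () }
    }

  extend : ∀ i → LastLRMaxUpTo π (inject₁ i) → LastLRMaxUpTo π (suc i)
  extend i r with isLRMax? π (suc i)
  ... | yes lr = record
    { pos       = suc i
    ; pos≤j     = ℕ.≤-refl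
    ; isLRMax   = lr
    ; last      = λ _ i<m m≤i _ → ℕ.<⇒≱ i<m m≤i
    ; dominates = dominates-new
    }
    where
    dominates-new : ∀ k → k ≤ suc i → π k ≤ π (suc i)
    dominates-new k k≤ with ≤⇒≡⊎< k≤
    ... | inj₁ refl = ℕ.≤-refl
    ... | inj₂ k<   = ℕ.<⇒≤ (lr k k<)
  ... | no ¬lr = record
    { pos       = pos
    ; pos≤j     = ℕ.≤-trans pos≤j (ℕ.<⇒≤ (Fin.≤̄⇒inject₁< (Fin.≤-refl {x = i})))
    ; isLRMax   = isLRMax
    ; last      = last-old
    ; dominates = dominates-old
    }
    where
    open LastLRMaxUpTo r
    last-old : ∀ m → pos < m → m ≤ suc i → ¬ IsLRMax π m
    last-old m pos<m m≤ with ≤⇒≡⊎< m≤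
    ... | inj₁ refl = ¬lr
    ... | inj₂ m<   = last m pos<m (Fin.<⇒≤pred m<)
    dominates-old : ∀ k → k ≤ suc i → π k ≤ π pos
    dominates-old k k≤ with ≤⇒≡⊎< k≤
    ... | inj₁ refl = let k′ , k′< , πk≤πk′ = dominated ¬lr
                      in ℕ.≤-trans πk≤πk′ (dominates k′ (Fin.<⇒≤pred k′<))
    ... | inj₂ k<   = dominates k (Fin.<⇒≤pred k<)

lastLRMax-pos : (r : LastLRMaxUpTo π j) → IsLRMax π h → h ≤ j →
                (∀ m → h < m → m ≤ j → ¬ IsLRMax π m) → LastLRMaxUpTo.pos r ≡ h
lastLRMax-pos {h = h} r lr h≤j none =
  Fin.≤-antisym (ℕ.≮⇒≥ (λ h<pos → none pos h<pos pos≤j isLRMax))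
                (ℕ.≮⇒≥ (λ pos<h → last h pos<h h≤j lr))
  where open LastLRMaxUpTo r

¬LRMax⇒inBlock : {π : Fin n → Fin n} {j : Fin n} → ¬ IsLRMax π j → ∃[ h ] (IsHGap π h × InBlock π h j)
¬LRMax⇒inBlock {n} {π} {j} ¬lr = pos , (isLRMax , next , toℕ-next , ¬lr-next) , pos<j , last
  where
  open LastLRMaxUpTo (lastLRMax π j)
  pos<j : pos < j
  pos<j = Fin.≤∧≢⇒< pos≤j (λ pos≡j → ¬lr (subst (IsLRMax π) pos≡j isLRMax))
  1+pos<n : suc (toℕ pos) <ℕ n
  1+pos<n = ℕ.≤-<-trans pos<j (Fin.toℕ<n j)
  next : Fin n
  next = fromℕ< 1+pos<n
  toℕ-next : toℕ next ≡ suc (toℕ pos)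
  toℕ-next = Fin.toℕ-fromℕ< 1+pos<n
  ¬lr-next : ¬ IsLRMax π next
  ¬lr-next = last next (subst (toℕ pos <ℕ_) (sym toℕ-next) ℕ.≤-refl)
                       (subst (_≤ℕ toℕ j) (sym toℕ-next) pos<j)

inBlock⇒¬LRMax : InBlock π h j → ¬ IsLRMax π j
inBlock⇒¬LRMax (h<j , none) = none _ h<j ℕ.≤-refl

inBlock⇒<LRMax : Injective _≡_ _≡_ π → IsLRMax π h → InBlock π h j → π j < π h
inBlock⇒<LRMax {π = π} {h = h} {j = j} inj lr (h<j , none) =
  Fin.≤∧≢⇒< πj≤πh (Fin.<⇒≢ h<j ∘ sym ∘ inj)
  where
  πj≤πh : π j ≤ π h
  πj≤πh = subst (λ p → π j ≤ π p) (lastLRMax-pos (lastLRMax π j) lr (ℕ.<⇒≤ h<j) none)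
                (LastLRMaxUpTo.dominates (lastLRMax π j) j Fin.≤-refl)

inBlock⇒<laterLRMax : h < h′ → IsLRMax π h′ → InBlock π h j → j < h′
inBlock⇒<laterLRMax h<h′ lr′ (_ , none) = ℕ.≰⇒> (λ h′≤j → none _ h<h′ h′≤j lr′)

inBlock-ordered : h < h′ → IsLRMax π h′ → InBlock π h j → InBlock π h′ j′ → j < j′
inBlock-ordered h<h′ lr′ bj (h′<j′ , _) = ℕ.<-trans (inBlock⇒<laterLRMax h<h′ lr′ bj) h′<j′

inBlock-decreasing : Injective _≡_ _≡_ π → ¬ Contains2143 π → ¬ Contains3142 π →
                     h < h′ → IsLRMax π h → IsLRMax π h′ →
                     InBlock π h j → InBlock π h′ j′ → π j′ < π j
inBlock-decreasing {π = π} {h = h} {h′ = h′} {j = j} {j′ = j′}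
                   inj no2143 no3142 h<h′ lr lr′ bj@(h<j , _) bj′@(h′<j′ , _) =
  Fin.≤∧≢⇒< (ℕ.≮⇒≥ πj≮πj′) (Fin.<⇒≢ j<j′ ∘ sym ∘ inj)
  where
  j<h′ : j < h′
  j<h′ = inBlock⇒<laterLRMax h<h′ lr′ bj
  j<j′ : j < j′
  j<j′ = ℕ.<-trans j<h′ h′<j′
  πj<πh : π j < π h
  πj<πh = inBlock⇒<LRMax inj lr bj
  πj′<πh′ : π j′ < π h′
  πj′<πh′ = inBlock⇒<LRMax inj lr′ bj′
  πh<πh′ : π h < π h′
  πh<πh′ = lr′ h h<h′
  πj≮πj′ : ¬ π j < π j′
  πj≮πj′ πj<πj′ with Fin.<-cmp (π j′) (π h)
  ... | tri< πj′<πh _ _ =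
    no3142 (h , j , h′ , j′ , h<j , j<h′ , h′<j′ , πj<πj′ , πj′<πh , πh<πh′)
  ... | tri≈ _ πj′≡πh _ = Fin.<⇒≢ (ℕ.<-trans h<j j<j′) (sym (inj πj′≡πh))
  ... | tri> _ _ πh<πj′ =
    no2143 (h , j , h′ , j′ , h<j , j<h′ , h′<j′ , πj<πh , πh<πj′ , πj′<πh′)

module _ {n : ℕ} (π : Fin n → Fin n) where

  blockPositions : Fin n → List (Fin n)
  blockPositions h = filter (inBlock? π h) (allFin n)

  nonLRMaxPositions : List (Fin n)
  nonLRMaxPositions = filter (λ i → ¬? (isLRMax? π i)) (allFin n)

  inBlock-blockPositions : ∀ h → All (InBlock π h) (blockPositions h)
  inBlock-blockPositions h = All.all-filter (inBlock? π h) (allFin n)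

  hgaps-pairs : ∀ {ℓ} {R : Rel (Fin n) ℓ} →
                (∀ {h h′} → h < h′ → IsHGap π h → IsHGap π h′ → R h h′) →
                AllPairs R (hgaps π)
  hgaps-pairs f = allPairs-filter (isHGap? π) (λ g g′ h<h′ → f h<h′ g g′) (allFin-sorted n)

  blockPositions-sorted : AllPairs _<_ (concat (map blockPositions (hgaps π)))
  blockPositions-sorted = AllPairs.concat⁺
    (All.map⁺ (All.tabulate (λ {h} _ → AllPairs.filter⁺ (inBlock? π h) (allFin-sorted n))))
    (AllPairs.map⁺ (hgaps-pairs (λ {h} {h′} h<h′ _ (lr′ , _) →
      all-cross (inBlock-ordered h<h′ lr′) (inBlock-blockPositions h) (inBlock-blockPositions h′))))

  nonLRMax⊆blocks : nonLRMaxPositions ⊆ concat (map blockPositions (hgaps π))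
  nonLRMax⊆blocks {j} j∈
    with h , gap , inBlk ← ¬LRMax⇒inBlock (proj₂ (∈-filter⁻ (λ i → ¬? (isLRMax? π i)) {xs = allFin n} j∈))
    = ∈-concat⁺′ (∈-filter⁺ (inBlock? π h) (∈-allFin j) inBlk)
                 (∈-map⁺ blockPositions (∈-filter⁺ (isHGap? π) (∈-allFin h) gap))

  blocks⊆nonLRMax : concat (map blockPositions (hgaps π)) ⊆ nonLRMaxPositions
  blocks⊆nonLRMax {j} j∈
    with _ , j∈block , block∈ ← ∈-concat⁻′ (map blockPositions (hgaps π)) j∈
    with h , _ , refl ← ∈-map⁻ blockPositions block∈
    = ∈-filter⁺ (λ i → ¬? (isLRMax? π i)) (∈-allFin j)
                (inBlock⇒¬LRMax (proj₂ (∈-filter⁻ (inBlock? π h) {xs = allFin n} j∈block)))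

  nonLRMaxPositions-≡ : nonLRMaxPositions ≡ concat (map blockPositions (hgaps π))
  nonLRMaxPositions-≡ = sorted-unique Fin.<-asym
    (AllPairs.filter⁺ (λ i → ¬? (isLRMax? π i)) (allFin-sorted n))
    blockPositions-sorted nonLRMax⊆blocks blocks⊆nonLRMax

lemma3 : (n : ℕ) (π : Fin n → Fin n) → Injective _≡_ _≡_ π →
         ¬ Contains2143 π → ¬ Contains3142 π →
         (nonLRMaxEntries π ≡ concat (map (block π) (hgaps π)))
         × AllPairs (λ B B′ → All (λ x → All (λ y → y < x) B′) B) (map (block π) (hgaps π))
lemma3 n π inj no2143 no3142 = entries-≡ , blocks-decreasing
  where
  open ≡-Reasoning
  entries-≡ : nonLRMaxEntries π ≡ concat (map (block π) (hgaps π))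
  entries-≡ = begin
    map π (nonLRMaxPositions π)                              ≡⟨ cong (map π) (nonLRMaxPositions-≡ π) ⟩
    map π (concat (map (blockPositions π) (hgaps π)))        ≡⟨ concat-map (map (blockPositions π) (hgaps π)) ⟨
    concat (map (map π) (map (blockPositions π) (hgaps π)))  ≡⟨ cong concat (map-∘ (hgaps π)) ⟨
    concat (map (block π) (hgaps π))                         ∎

  blocks-decreasing : AllPairs (λ B B′ → All (λ x → All (λ y → y < x) B′) B) (map (block π) (hgaps π))
  blocks-decreasing = AllPairs.map⁺ (hgaps-pairs π (λ {h} {h′} h<h′ (lr , _) (lr′ , _) →
    All.map⁺ (All.map All.map⁺
      (all-cross (inBlock-decreasing inj no2143 no3142 h<h′ lr lr′)
                 (inBlock-blockPositions π h) (inBlock-blockPositions π h′)))))
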